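{- Consider augmentations $\mathfrak q, \mathfrak p$ on $A$, and an isomorphism of configurations $\varphi : D(\mathfrak q) \cong D(\mathfrak p)$. Then $\mathfrak q \sim^\varphi \mathfrak p$ iff $\mathfrak q \sim \mathfrak p$.
   Context: $A$ well-opened arena; $\prec$ denotes immediate causality in any order. An augmentation $\mathfrak q$ has events $|\mathfrak q|$, a configuration $D(\mathfrak q)=(|\mathfrak q|,\le_{D(\mathfrak q)},\partial_{\mathfrak q})$ and a tree order $\le_{\mathfrak q}$ that is rule-abiding ($\le_{D(\mathfrak q)}\subseteq\le_{\mathfrak q}$), courteous (if $a_1\prec_{\mathfrak q}a_2$ with $\lambda(a_1)=+$ or $\lambda(a_2)=-$ then $a_1\prec_{D(\mathfrak q)}a_2$) and deterministic; $\mathrm{init}(\mathfrak q)$ is the root; $\mathrm{just}(a)$ is the unique $a''\prec_{D(\mathfrak q)}a$. An isomorphism of configurations is a display-preserving bijection preserving and reflecting immediate causality. A context $\Gamma$ between $\mathfrak q,\mathfrak p$ is a display-preserving bijection from a set of negative events of $\mathfrak q$ onto a set of events of $\mathfrak p$; $\Gamma\vdash(a,b)$ means no $a'\in\mathrm{dom}(\Gamma)$ has $a'>_{\mathfrak q}a$ and no $b'\in\mathrm{cod}(\Gamma)$ has $b'>_{\mathfrak p}b$. (i) Bisimulation across $\varphi$: $a\sim^\varphi_\Gamma b$ holds inductively if: (a) $\partial_{\mathfrak q}(a)=\partial_{\mathfrak p}(b)$ and $\Gamma\vdash(a,b)$; (b) if $a$ positive and $\mathrm{just}(a)\in\mathrm{dom}(\Gamma)$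 then $\mathrm{just}(b)\in\mathrm{cod}(\Gamma)$ and $\Gamma(\mathrm{just}(a))=\mathrm{just}(b)$; (c) if $a$ positive and $\mathrm{just}(a)\notin\mathrm{dom}(\Gamma)$ then $\mathrm{just}(b)\notin\mathrm{cod}(\Gamma)$ and $\varphi(\mathrm{just}(a))=\mathrm{just}(b)$; (1) if $a$ positive and $a\prec_{\mathfrak q}a'$ there is $b\prec_{\mathfrak p}b'$ with $a'\sim^\varphi_{\Gamma\cup\{(a',b')\}}b'$, and symmetrically; (2) if $a$ negative and $a\prec_{\mathfrak q}a'$ there is $b\prec_{\mathfrak p}b'$ with $a'\sim^\varphi_\Gamma b'$, and symmetrically. $\mathfrak q\sim^\varphi\mathfrak p$ means $\mathrm{init}(\mathfrak q)\sim^\varphi_\emptyset\mathrm{init}(\mathfrak p)$. (ii) Variant without isomorphism: $a\sim_\Gamma b$ holds inductively if (a) as in (i); (b) if $a$ positive then $\mathrm{just}(a)\in\mathrm{dom}(\Gamma)$ and $\Gamma(\mathrm{just}(a))=\mathrm{just}(b)$; (1),(2) as in (i) with $\sim$ in place of $\sim^\varphi$. $\mathfrak q\sim\mathfrak p$ means $\mathrm{init}(\mathfrak q)\sim_{\{(\mathrm{init}(\mathfrak q),\mathrm{init}(\mathfrak p))\}}\mathrm{init}(\mathfrak p)$. -}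

module Defs where

open import Data.Nat using (ℕ)
open import Data.Fin using (Fin)
open import Data.List using (List)
open import Data.List.Membership.Propositional using (_∈_)
open import Data.Product using (Σ; ∃; _×_; _,_)
open import Data.Sum using (_⊎_)
open import Data.Empty using (⊥)
open import Relation.Nullary using (¬_)
open import Relation.Binary.PropositionalEquality using (_≡_; _≢_)
open import Relation.Binary.Structures using (IsPartialOrder)
open import Function.Bundles using (_↔_; Inverse)

module _ {E : Set} (_≤_ : E → E → Set) where

  Strict : E → E → Set
  Strict a b = a ≤ b × a ≢ b

  Imm : E → E → Set
  Imm a b = Strict a b × (∀ c → a ≤ c → c ≤ b → c ≡ a ⊎ c ≡ b)

  Minimal : E → Set
  Minimal a = ∀ b → b ≤ a → b ≡ a

  Forestial : Set
  Forestial = ∀ a₁ a₂ a₃ → a₁ ≤ a₃ → a₂ ≤ a₃ → a₁ ≤ a₂ ⊎ a₂ ≤ a₁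

data Pol : Set where
  + - : Pol

record Arena : Set₁ where
  field
    Move       : Set
    _≤A_       : Move → Move → Set
    isPO       : IsPartialOrder _≡_ _≤A_
    pol        : Move → Pol
    finitary   : ∀ a → Σ (List Move) λ l → ∀ b → b ≤A a → b ∈ l
    forestial  : Forestial _≤A_
    alternating : ∀ a₁ a₂ → Imm _≤A_ a₁ a₂ → pol a₁ ≢ pol a₂
    negative   : ∀ a → Minimal _≤A_ a → pol a ≡ -

WellOpened : Arena → Set
WellOpened A = Σ (Arena.Move A) λ a → Minimal (Arena._≤A_ A) a
                 × (∀ b → Minimal (Arena._≤A_ A) b → b ≡ a)

record Configuration (A : Arena) : Set₁ where
  open Arena A
  field
    size      : ℕ
    _≤x_      : Fin size → Fin size → Set
    isPO      : IsPartialOrder _≡_ _≤x_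
    forestial : Forestial _≤x_
    ∂         : Fin size → Move
    minimal-resp : ∀ a → (Minimal _≤x_ a → Minimal _≤A_ (∂ a))
                       × (Minimal _≤A_ (∂ a) → Minimal _≤x_ a)
    causal-pres  : ∀ a₁ a₂ → Imm _≤x_ a₁ a₂ → Imm _≤A_ (∂ a₁) (∂ a₂)

record ConfIso {A : Arena} (x y : Configuration A) : Set where
  open Configuration
  field
    bij     : Fin (size x) ↔ Fin (size y)
  φ : Fin (size x) → Fin (size y)
  φ = Inverse.to bij
  field
    display : ∀ a → ∂ y (φ a) ≡ ∂ x a
    imm-iff : ∀ a₁ a₂ → (Imm (_≤x_ x) a₁ a₂ → Imm (_≤x_ y) (φ a₁) (φ a₂))
                      × (Imm (_≤x_ y) (φ a₁) (φ a₂) → Imm (_≤x_ x) a₁ a₂)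

record Augmentation (A : Arena) : Set₁ where
  field
    D : Configuration A
  open Configuration D public using (size; ∂) renaming (_≤x_ to _≤D_)
  Ev : Set
  Ev = Fin size
  λq : Ev → Pol
  λq a = Arena.pol A (∂ a)
  field
    _≤q_       : Ev → Ev → Set
    isPO-q     : IsPartialOrder _≡_ _≤q_
    forestial-q : Forestial _≤q_
    init       : Ev
    init-least : ∀ a → init ≤q a
    rule-abiding : ∀ a₁ a₂ → a₁ ≤D a₂ → a₁ ≤q a₂
    courteous  : ∀ a₁ a₂ → Imm _≤q_ a₁ a₂ → (λq a₁ ≡ + ⊎ λq a₂ ≡ -)
                 → Imm _≤D_ a₁ a₂
    deterministic : ∀ a a₁ a₂ → λq a ≡ - → Imm _≤q_ a a₁ → Imm _≤q_ a a₂
                    → λq a₁ ≡ + → λq a₂ ≡ + → a₁ ≡ a₂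

module _ {A : Arena} (q p : Augmentation A) where
  private
    module Q = Augmentation q
    module P = Augmentation p

  -- a context, given as a (partial bijective) relation between events
  Ctx : Set₁
  Ctx = Q.Ev → P.Ev → Set

  InDom : Ctx → Q.Ev → Set
  InDom Γ a = ∃ λ b → Γ a b

  InCod : Ctx → P.Ev → Set
  InCod Γ b = ∃ λ a → Γ a b

  extend : Ctx → Q.Ev → P.Ev → Ctx
  extend Γ a b a₀ b₀ = Γ a₀ b₀ ⊎ (a₀ ≡ a × b₀ ≡ b)

  _⊢_,_ : Ctx → Q.Ev → P.Ev → Set
  Γ ⊢ a , b = (∀ a' → InDom Γ a' → ¬ Strict Q._≤q_ a a')
            × (∀ b' → InCod Γ b' → ¬ Strict P._≤q_ b b')

  -- (i) bisimulation across φ.  just(a) is the unique a'' ⋖_{D(q)} a;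
  -- conditions on just(−) quantify over the (unique) justifiers.
  data SimIso (φ : ConfIso Q.D P.D) : Ctx → Q.Ev → P.Ev → Set₁ where
    sim : ∀ {Γ a b} →
      Configuration.∂ Q.D a ≡ Configuration.∂ P.D b →
      Γ ⊢ a , b →
      (Q.λq a ≡ + → ∀ ja jb → Imm Q._≤D_ ja a → Imm P._≤D_ jb b →
          InDom Γ ja → InCod Γ jb × Γ ja jb) →
      (Q.λq a ≡ + → ∀ ja jb → Imm Q._≤D_ ja a → Imm P._≤D_ jb b →
          ¬ InDom Γ ja → ¬ InCod Γ jb × ConfIso.φ φ ja ≡ jb) →
      (Q.λq a ≡ + → ∀ a' → Imm Q._≤q_ a a' →
          ∃ λ b' → Imm P._≤q_ b b' × SimIso φ (extend Γ a' b') a' b') →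
      (Q.λq a ≡ + → ∀ b' → Imm P._≤q_ b b' →
          ∃ λ a' → Imm Q._≤q_ a a' × SimIso φ (extend Γ a' b') a' b') →
      (Q.λq a ≡ - → ∀ a' → Imm Q._≤q_ a a' →
          ∃ λ b' → Imm P._≤q_ b b' × SimIso φ Γ a' b') →
      (Q.λq a ≡ - → ∀ b' → Imm P._≤q_ b b' →
          ∃ λ a' → Imm Q._≤q_ a a' × SimIso φ Γ a' b') →
      SimIso φ Γ a b

  data Sim : Ctx → Q.Ev → P.Ev → Set₁ where
    sim : ∀ {Γ a b} →
      Configuration.∂ Q.D a ≡ Configuration.∂ P.D b →
      Γ ⊢ a , b →
      (Q.λq a ≡ + → ∀ ja jb → Imm Q._≤D_ ja a → Imm P._≤D_ jb b →
          InDom Γ ja × Γ ja jb) →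
      (Q.λq a ≡ + → ∀ a' → Imm Q._≤q_ a a' →
          ∃ λ b' → Imm P._≤q_ b b' × Sim (extend Γ a' b') a' b') →
      (Q.λq a ≡ + → ∀ b' → Imm P._≤q_ b b' →
          ∃ λ a' → Imm Q._≤q_ a a' × Sim (extend Γ a' b') a' b') →
      (Q.λq a ≡ - → ∀ a' → Imm Q._≤q_ a a' →
          ∃ λ b' → Imm P._≤q_ b b' × Sim Γ a' b') →
      (Q.λq a ≡ - → ∀ b' → Imm P._≤q_ b b' →
          ∃ λ a' → Imm Q._≤q_ a a' × Sim Γ a' b') →
      Sim Γ a b

  emptyCtx : Ctx
  emptyCtx _ _ = ⊥

  singletonCtx : Q.Ev → P.Ev → Ctx
  singletonCtx a b a₀ b₀ = a₀ ≡ a × b₀ ≡ b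

  BisimIso : ConfIso Q.D P.D → Set₁
  BisimIso φ = SimIso φ emptyCtx Q.init P.init

  Bisim : Set₁
  Bisim = Sim (singletonCtx Q.init P.init) Q.init P.init

{-# OPTIONS --safe #-}
module Submission where

-- Following both trees down from the roots, the context Γ contains every
-- non-initial negative ancestor of the current pair of events, and never a
-- root.  So the justifier of a positive event is either in dom Γ or is the
-- root; clause (c) of ∼^φ therefore only ever speaks about the two roots, where
-- it holds for every φ, because the root is the unique D-minimal event and
-- isomorphisms preserve D-minimality.  Hence clauses (b)+(c) of ∼^φ_Γ say the
-- same as clause (b) of ∼_Δ for Δ = Γ ∪ {(init, init)}.

open import Defs
open import Data.Fin using (_≟_)
open import Data.List using (List; []; _∷_; allFin)
open import Data.List.Membership.Propositional using (_∈_)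
open import Data.List.Membership.Propositional.Properties using (∈-allFin)
open import Data.List.Relation.Unary.Any using (tail)
open import Data.Product using (_×_; _,_; proj₁; proj₂)
open import Data.Sum using (_⊎_; inj₁; inj₂; [_,_])
open import Data.Empty using (⊥; ⊥-elim)
open import Function using (_∘_; id)
open import Function.Bundles using (_⇔_; mk⇔; Equivalence)
open import Relation.Binary.Definitions using (DecidableEquality)
open import Relation.Binary.PropositionalEquality using (_≡_; _≢_; refl; sym; trans; subst; cong)
open import Relation.Binary.Structures using (IsPartialOrder)
open import Relation.Nullary using (¬_; yes; no)
open import Relation.Nullary.Decidable using (¬¬-excluded-middle)
import Relation.Binary.Construct.NonStrictToStrict as NonStrictToStrict

+≢- : + ≢ -
+≢- ()

≢+⇒≡- : ∀ {x : Pol} → x ≢ + → x ≡ -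
≢+⇒≡- {+} x≢+ = ⊥-elim (x≢+ refl)
≢+⇒≡- { - } _ = refl

≢-⇒≡+ : ∀ {x : Pol} → x ≢ - → x ≡ +
≢-⇒≡+ {+} _ = refl
≢-⇒≡+ { - } x≢- = ⊥-elim (x≢- refl)

module FinitePoset {E : Set} (_≟ᴱ_ : DecidableEquality E) {_≤_ : E → E → Set}
                   (po : IsPartialOrder _≡_ _≤_)
                   (elems : List E) (complete : ∀ x → x ∈ elems) where

  open NonStrictToStrict _≡_ _≤_ using (_<_; <-trans; <-irrefl)

  -- Search the open interval (c , e) through the list: whenever a listed
  -- element lies in it, it becomes the new lower end.
  ∄⋖⇒∄< : ∀ {e} → (∀ d → ¬ Imm _≤_ d e) → ∀ {c} → ¬ c < e
  ∄⋖⇒∄< {e} ∄⋖ c<e = search elems c<e (λ x _ _ → complete x)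
    where
    search : (L : List E) → ∀ {c} → c < e → (∀ x → c < x → x < e → x ∈ L) → ⊥
    search [] {c} c<e covered = ∄⋖ c (c<e , endpoints)
      where
      endpoints : ∀ x → c ≤ x → x ≤ e → x ≡ c ⊎ x ≡ e
      endpoints x c≤x x≤e with x ≟ᴱ c | x ≟ᴱ e
      ... | yes x≡c | _       = inj₁ x≡c
      ... | no _    | yes x≡e = inj₂ x≡e
      ... | no x≢c  | no x≢e  with covered x (c≤x , x≢c ∘ sym) (x≤e , x≢e)
      ...   | ()
    search (y ∷ L) {c} c<e covered = ¬¬-excluded-middle {A = c < y × y < e} λ where
      (yes (c<y , y<e)) → search L y<e λ x y<x x<e →
        tail (λ x≡y → <-irrefl (sym x≡y) y<x) (covered x (<-trans po c<y y<x) x<e)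
      (no ¬c<y<e) → search L c<e λ x c<x x<e →
        tail (λ { refl → ¬c<y<e (c<x , x<e) }) (covered x c<x x<e)

module AugmentationFacts {A : Arena} (r : Augmentation A) where
  open Arena A using (alternating; negative)
  open Augmentation r
  open Configuration D using (causal-pres; minimal-resp)
  open IsPartialOrder isPO-q using (antisym; reflexive)
  open NonStrictToStrict _≡_ _≤q_ using (_<_)
  open FinitePoset _≟_ isPO-q (allFin size) ∈-allFin using (∄⋖⇒∄<)

  ≤init⇒≡init : ∀ {x} → x ≤q init → x ≡ init
  ≤init⇒≡init x≤init = antisym x≤init (init-least _)

  ≮init : ∀ {x} → ¬ x < init
  ≮init (x≤init , x≢init) = x≢init (≤init⇒≡init x≤init)

  ⋖⇒≢init : ∀ {a a'} → Imm _≤q_ a a' → a' ≢ init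
  ⋖⇒≢init (a<a' , _) refl = ≮init a<a'

  <-⋖⇒≤ : ∀ {a a' c} → Imm _≤q_ a a' → c < a' → c ≤q a
  <-⋖⇒≤ {a} {a'} {c} ((a≤a' , _) , onlyEnds) (c≤a' , c≢a')
    with forestial-q c a a' c≤a' a≤a'
  ... | inj₁ c≤a = c≤a
  ... | inj₂ a≤c with onlyEnds c a≤c c≤a'
  ...   | inj₁ c≡a  = reflexive c≡a
  ...   | inj₂ c≡a' = ⊥-elim (c≢a' c≡a')

  ⋖D⇒λ≢ : ∀ {a a'} → Imm _≤D_ a a' → λq a ≢ λq a'
  ⋖D⇒λ≢ a⋖a' = alternating _ _ (causal-pres _ _ a⋖a')

  justifier-negative : ∀ {j a} → λq a ≡ + → Imm _≤D_ j a → λq j ≡ -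
  justifier-negative a⁺ j⋖a = ≢+⇒≡- λ j⁺ → ⋖D⇒λ≢ j⋖a (trans j⁺ (sym a⁺))

  ⋖-after-negative-positive : ∀ {a a'} → λq a ≡ - → Imm _≤q_ a a' → λq a' ≡ +
  ⋖-after-negative-positive a⁻ a⋖a' = ≢-⇒≡+ λ a'⁻ →
    ⋖D⇒λ≢ (courteous _ _ a⋖a' (inj₂ a'⁻)) (trans a⁻ (sym a'⁻))

  init-D-minimal : Minimal _≤D_ init
  init-D-minimal b b≤init = ≤init⇒≡init (rule-abiding b init b≤init)

  -- A ≤q-predecessor of the negative event e would, by courtesy, be a
  -- D-predecessor; so e has none, and finiteness then puts nothing below e.
  D-minimal⇒≡init : ∀ {e} → Minimal _≤D_ e → e ≡ init
  D-minimal⇒≡init {e} e-min with e ≟ init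
  ... | yes e≡init = e≡init
  ... | no e≢init  = ⊥-elim (∄⋖⇒∄< ∄⋖ (init-least e , e≢init ∘ sym))
    where
    e⁻ : λq e ≡ -
    e⁻ = negative (∂ e) (proj₁ (minimal-resp e) e-min)
    ∄⋖ : ∀ d → ¬ Imm _≤q_ d e
    ∄⋖ d d⋖e with (d≤e , d≢e) , _ ← courteous d e d⋖e (inj₂ e⁻) = d≢e (e-min d d≤e)

  NegativesBelow⊆ : Ev → (Ev → Set) → Set
  NegativesBelow⊆ a S = ∀ {c} → c ≤q a → λq c ≡ - → c ≢ init → S c

  negativesBelow-⋖ : ∀ {a a' S} → NegativesBelow⊆ a S → Imm _≤q_ a a'
                   → NegativesBelow⊆ a' (λ c → c ≡ a' ⊎ S c)
  negativesBelow-⋖ {a' = a'} below⊆S a⋖a' {c} c≤a' c⁻ c≢init with c ≟ a'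
  ... | yes c≡a' = inj₁ c≡a'
  ... | no c≢a'  = inj₂ (below⊆S (<-⋖⇒≤ a⋖a' (c≤a' , c≢a')) c⁻ c≢init)

  negativesBelow-⋖⁻ : ∀ {a a' S} → λq a ≡ - → NegativesBelow⊆ a S → Imm _≤q_ a a'
                    → NegativesBelow⊆ a' S
  negativesBelow-⋖⁻ a⁻ below⊆S a⋖a' c≤a' c⁻ c≢init =
    [ (λ { refl → ⊥-elim (+≢- (trans (sym (⋖-after-negative-positive a⁻ a⋖a')) c⁻)) })
    , id ]
      (negativesBelow-⋖ below⊆S a⋖a' c≤a' c⁻ c≢init)

  justifier-init-or-∈ : ∀ {a j S} → NegativesBelow⊆ a S → λq a ≡ + → Imm _≤D_ j a
                      → j ≡ init ⊎ S j
  justifier-init-or-∈ {j = j} below⊆S a⁺ j⋖a with j ≟ init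
  ... | yes j≡init = inj₁ j≡init
  ... | no j≢init  = inj₂ (below⊆S (rule-abiding _ _ (proj₁ (proj₁ j⋖a)))
                                   (justifier-negative a⁺ j⋖a) j≢init)

module Correspondence {A : Arena} (q p : Augmentation A)
                      (φ : ConfIso (Augmentation.D q) (Augmentation.D p)) where
  private
    module Q = Augmentation q
    module P = Augmentation p
    module Qf = AugmentationFacts q
    module Pf = AugmentationFacts p
  open Equivalence using (to; from)

  φ-init : ConfIso.φ φ Q.init ≡ P.init
  φ-init = Pf.D-minimal⇒≡init (proj₂ (Configuration.minimal-resp P.D _)
    (subst (Minimal (Arena._≤A_ A)) (sym (ConfIso.display φ Q.init))
      (proj₁ (Configuration.minimal-resp Q.D Q.init) Qf.init-D-minimal)))

  initPair : Ctx q p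
  initPair = singletonCtx q p Q.init P.init

  _∪_ : Ctx q p → Ctx q p → Ctx q p
  (Γ ∪ Δ) a b = Γ a b ⊎ Δ a b

  _≐_ : Ctx q p → Ctx q p → Set
  Γ ≐ Δ = ∀ {a b} → Γ a b ⇔ Δ a b

  singleton≐∅∪initPair : initPair ≐ (emptyCtx q p ∪ initPair)
  singleton≐∅∪initPair = mk⇔ inj₂ [ (λ ()) , id ]

  extend-≐ : ∀ {Γ Δ a b} → Δ ≐ (Γ ∪ initPair)
           → extend q p Δ a b ≐ (extend q p Γ a b ∪ initPair)
  extend-≐ Δ≐ = mk⇔
    [ [ inj₁ ∘ inj₁ , inj₂ ] ∘ to Δ≐ , inj₁ ∘ inj₂ ]
    [ [ inj₁ ∘ from Δ≐ ∘ inj₁ , inj₂ ] , inj₁ ∘ from Δ≐ ∘ inj₂ ]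

  ⊢-+init : ∀ {Γ Δ a b} → Δ ≐ (Γ ∪ initPair) → _⊢_,_ q p Γ a b → _⊢_,_ q p Δ a b
  ⊢-+init Δ≐ (Γ⊢ᵃ , Γ⊢ᵇ) =
      (λ a' (y , δ) a<a' → [ (λ γ → Γ⊢ᵃ a' (y , γ) a<a')
                           , (λ { (refl , _) → Qf.≮init a<a' }) ] (to Δ≐ δ))
    , (λ b' (x , δ) b<b' → [ (λ γ → Γ⊢ᵇ b' (x , γ) b<b')
                           , (λ { (_ , refl) → Pf.≮init b<b' }) ] (to Δ≐ δ))

  ⊢-−init : ∀ {Γ Δ a b} → Δ ≐ (Γ ∪ initPair) → _⊢_,_ q p Δ a b → _⊢_,_ q p Γ a b
  ⊢-−init Δ≐ (Δ⊢ᵃ , Δ⊢ᵇ) =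
      (λ a' (y , γ) → Δ⊢ᵃ a' (y , from Δ≐ (inj₁ γ)))
    , (λ b' (x , γ) → Δ⊢ᵇ b' (x , from Δ≐ (inj₁ γ)))

  record Saturated (Γ : Ctx q p) (a : Q.Ev) (b : P.Ev) : Set where
    field
      init∉dom : ¬ InDom q p Γ Q.init
      init∉cod : ¬ InCod q p Γ P.init
      dom-saturated : Qf.NegativesBelow⊆ a (InDom q p Γ)
      cod-saturated : Pf.NegativesBelow⊆ b (InCod q p Γ)
  open Saturated

  saturated-init : Saturated (emptyCtx q p) Q.init P.init
  saturated-init = record
    { init∉dom = λ ()
    ; init∉cod = λ ()
    ; dom-saturated = λ c≤init _ c≢init → ⊥-elim (c≢init (Qf.≤init⇒≡init c≤init))
    ; cod-saturated = λ c≤init _ c≢init → ⊥-elim (c≢init (Pf.≤init⇒≡init c≤init))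
    }

  saturated-⋖⁺ : ∀ {Γ a b a' b'} → Saturated Γ a b → Imm Q._≤q_ a a' → Imm P._≤q_ b b'
               → Saturated (extend q p Γ a' b') a' b'
  saturated-⋖⁺ {a' = a'} {b'} S a⋖a' b⋖b' = record
    { init∉dom = λ where
        (y , inj₁ γ) → init∉dom S (y , γ)
        (_ , inj₂ (init≡a' , _)) → Qf.⋖⇒≢init a⋖a' (sym init≡a')
    ; init∉cod = λ where
        (x , inj₁ γ) → init∉cod S (x , γ)
        (_ , inj₂ (_ , init≡b')) → Pf.⋖⇒≢init b⋖b' (sym init≡b')
    ; dom-saturated = λ c≤a' c⁻ c≢init →
        [ (λ c≡a' → b' , inj₂ (c≡a' , refl)) , (λ (y , γ) → y , inj₁ γ) ]
          (Qf.negativesBelow-⋖ (dom-saturated S) a⋖a' c≤a' c⁻ c≢init)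
    ; cod-saturated = λ c≤b' c⁻ c≢init →
        [ (λ c≡b' → a' , inj₂ (refl , c≡b')) , (λ (x , γ) → x , inj₁ γ) ]
          (Pf.negativesBelow-⋖ (cod-saturated S) b⋖b' c≤b' c⁻ c≢init)
    }

  λ-transport : ∀ {a b} → Configuration.∂ Q.D a ≡ Configuration.∂ P.D b
              → ∀ {x} → Q.λq a ≡ x → P.λq b ≡ x
  λ-transport ∂a≡∂b = trans (cong (Arena.pol A) (sym ∂a≡∂b))

  saturated-⋖⁻ : ∀ {Γ a b a' b'} → Configuration.∂ Q.D a ≡ Configuration.∂ P.D b
               → Q.λq a ≡ - → Saturated Γ a b → Imm Q._≤q_ a a' → Imm P._≤q_ b b'
               → Saturated Γ a' b'
  saturated-⋖⁻ ∂a≡∂b a⁻ S a⋖a' b⋖b' = record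
    { init∉dom = init∉dom S
    ; init∉cod = init∉cod S
    ; dom-saturated = Qf.negativesBelow-⋖⁻ a⁻ (dom-saturated S) a⋖a'
    ; cod-saturated = Pf.negativesBelow-⋖⁻ (λ-transport ∂a≡∂b a⁻) (cod-saturated S) b⋖b'
    }

  simIso⇒sim : ∀ {Γ Δ a b} → Δ ≐ (Γ ∪ initPair) → Saturated Γ a b
             → SimIso q p φ Γ a b → Sim q p Δ a b
  simIso⇒sim {_} {Δ} {a} {b} Δ≐ S (sim ∂a≡∂b Γ⊢ just∈dom just∉dom ⁺→ ⁺← ⁻→ ⁻←) =
    sim ∂a≡∂b (⊢-+init Δ≐ Γ⊢)
      (λ a⁺ _ jb ja⋖a jb⋖b → let δ = justifiers∈Δ a⁺ ja⋖a jb⋖b in (jb , δ) , δ)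
      (λ a⁺ a' a⋖a' → let b' , b⋖b' , s = ⁺→ a⁺ a' a⋖a'
        in b' , b⋖b' , simIso⇒sim (extend-≐ Δ≐) (saturated-⋖⁺ S a⋖a' b⋖b') s)
      (λ a⁺ b' b⋖b' → let a' , a⋖a' , s = ⁺← a⁺ b' b⋖b'
        in a' , a⋖a' , simIso⇒sim (extend-≐ Δ≐) (saturated-⋖⁺ S a⋖a' b⋖b') s)
      (λ a⁻ a' a⋖a' → let b' , b⋖b' , s = ⁻→ a⁻ a' a⋖a'
        in b' , b⋖b' , simIso⇒sim Δ≐ (saturated-⋖⁻ ∂a≡∂b a⁻ S a⋖a' b⋖b') s)
      (λ a⁻ b' b⋖b' → let a' , a⋖a' , s = ⁻← a⁻ b' b⋖b'
        in a' , a⋖a' , simIso⇒sim Δ≐ (saturated-⋖⁻ ∂a≡∂b a⁻ S a⋖a' b⋖b') s)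
    where
    justifiers∈Δ : Q.λq a ≡ + → ∀ {ja jb} → Imm Q._≤D_ ja a → Imm P._≤D_ jb b → Δ ja jb
    justifiers∈Δ a⁺ {ja} {jb} ja⋖a jb⋖b
      with Qf.justifier-init-or-∈ (dom-saturated S) a⁺ ja⋖a
    ... | inj₂ ja∈dom = from Δ≐ (inj₁ (proj₂ (just∈dom a⁺ ja jb ja⋖a jb⋖b ja∈dom)))
    ... | inj₁ refl with Pf.justifier-init-or-∈ (cod-saturated S) (λ-transport ∂a≡∂b a⁺) jb⋖b
    ...   | inj₁ refl = from Δ≐ (inj₂ (refl , refl))
    ...   | inj₂ jb∈cod = ⊥-elim (proj₁ (just∉dom a⁺ ja jb ja⋖a jb⋖b (init∉dom S)) jb∈cod)

  sim⇒simIso : ∀ {Γ Δ a b} → Δ ≐ (Γ ∪ initPair) → Saturated Γ a b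
             → Sim q p Δ a b → SimIso q p φ Γ a b
  sim⇒simIso {Γ} {Δ} {a} {b} Δ≐ S (sim ∂a≡∂b Δ⊢ justifiers ⁺→ ⁺← ⁻→ ⁻←) =
    sim ∂a≡∂b (⊢-−init Δ≐ Δ⊢) just∈dom just∉dom
      (λ a⁺ a' a⋖a' → let b' , b⋖b' , s = ⁺→ a⁺ a' a⋖a'
        in b' , b⋖b' , sim⇒simIso (extend-≐ Δ≐) (saturated-⋖⁺ S a⋖a' b⋖b') s)
      (λ a⁺ b' b⋖b' → let a' , a⋖a' , s = ⁺← a⁺ b' b⋖b'
        in a' , a⋖a' , sim⇒simIso (extend-≐ Δ≐) (saturated-⋖⁺ S a⋖a' b⋖b') s)
      (λ a⁻ a' a⋖a' → let b' , b⋖b' , s = ⁻→ a⁻ a' a⋖a'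
        in b' , b⋖b' , sim⇒simIso Δ≐ (saturated-⋖⁻ ∂a≡∂b a⁻ S a⋖a' b⋖b') s)
      (λ a⁻ b' b⋖b' → let a' , a⋖a' , s = ⁻← a⁻ b' b⋖b'
        in a' , a⋖a' , sim⇒simIso Δ≐ (saturated-⋖⁻ ∂a≡∂b a⁻ S a⋖a' b⋖b') s)
    where
    justifiers∈Γ∪init : Q.λq a ≡ + → ∀ ja jb → Imm Q._≤D_ ja a → Imm P._≤D_ jb b
                      → Γ ja jb ⊎ initPair ja jb
    justifiers∈Γ∪init a⁺ ja jb ja⋖a jb⋖b = to Δ≐ (proj₂ (justifiers a⁺ ja jb ja⋖a jb⋖b))

    just∈dom : Q.λq a ≡ + → ∀ ja jb → Imm Q._≤D_ ja a → Imm P._≤D_ jb b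
             → InDom q p Γ ja → InCod q p Γ jb × Γ ja jb
    just∈dom a⁺ ja jb ja⋖a jb⋖b ja∈dom with justifiers∈Γ∪init a⁺ ja jb ja⋖a jb⋖b
    ... | inj₁ γ = (ja , γ) , γ
    ... | inj₂ (refl , _) = ⊥-elim (init∉dom S ja∈dom)

    just∉dom : Q.λq a ≡ + → ∀ ja jb → Imm Q._≤D_ ja a → Imm P._≤D_ jb b
             → ¬ InDom q p Γ ja → ¬ InCod q p Γ jb × ConfIso.φ φ ja ≡ jb
    just∉dom a⁺ ja jb ja⋖a jb⋖b ja∉dom with justifiers∈Γ∪init a⁺ ja jb ja⋖a jb⋖b
    ... | inj₁ γ = ⊥-elim (ja∉dom (jb , γ))
    ... | inj₂ (refl , refl) = init∉cod S , φ-init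

lemma33 : (A : Arena) → WellOpened A → (q p : Augmentation A)
          → (φ : ConfIso (Augmentation.D q) (Augmentation.D p))
          → BisimIso q p φ ⇔ Bisim q p
lemma33 A _ q p φ = mk⇔ (simIso⇒sim singleton≐∅∪initPair saturated-init)
                        (sim⇒simIso singleton≐∅∪initPair saturated-init)
  where open Correspondence q p φ
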